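{- Let $n\ge 2$ and $p\in(0,1)$. Suppose a random directed graph is generated as follows: a permutation $\pi=(\pi_1,\dots,\pi_n)$ of $V=[n]$ is chosen uniformly at random and the true order is $\pi_1\prec\pi_2\prec\cdots\prec\pi_n$; the edges $(\pi_1,\pi_2),\dots,(\pi_{n-1},\pi_n)$ are added; and each other pair $\{i,j\}$ is added independently with probability $p$. Let $G=(V,E)$ be the resulting undirected graph. Fix an undirected graph $G$ and a set $E'$ of directed edges whose underlying undirected edges lie in $E$, and condition on the events that the undirected graph equals $G$ and that every directed edge in $E'$ is oriented according to the true order. Then the conditional distribution of the true ordering is uniform over all permutations $\sigma$ that are consistent with $G$ and $E'$.
   Context: A permutation $\sigma=(\sigma_1,\dots,\sigma_n)$ of $V$ is consistent with $G=(V,E)$ and a set $E'$ of directed edges if $(\sigma_k,\sigma_{k+1})\in E$ (as undirected edges) for all $1\le k<n$, and for every directed edge $(u,v)\in E'$, $u$ precedes $v$ in $\sigma$.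
   Formalization: The edge probability p ranges over the rationals in the interval (0,1). -}

module Defs where

open import Data.Bool using (Bool; true; false; if_then_else_; _∧_; _∨_; not)
open import Data.Nat as ℕ using (ℕ; zero; suc)
open import Data.Fin using (Fin; toℕ)
open import Data.Fin.Properties using (_≟_)
open import Data.List using (List; []; _∷_; map; concatMap; filter; foldr; length; allFin; cartesianProduct)
open import Data.Vec using (Vec; toList) renaming ([] to []ᵥ; _∷_ to _∷ᵥ_)
open import Data.Product using (_×_; _,_)
open import Data.Integer using (+_)
open import Data.Rational using (ℚ; 0ℚ; 1ℚ; _*_; _-_; _+_; _<_; _÷_; _/_; >-nonZero)
open import Relation.Nullary.Decidable using (does)
open import Relation.Binary.PropositionalEquality using (_≡_)
open import Data.List.Membership.Propositional using (_∈_)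
open import Data.Bool using (T?)

-- Vertex set V = [n], represented as Fin n.
-- An undirected graph on V is a symmetric irreflexive Boolean adjacency relation.
Adj : ℕ → Set
Adj n = Fin n → Fin n → Bool

Symmetric : ∀ {n} → Adj n → Set
Symmetric {n} E = (i j : Fin n) → E i j ≡ E j i

Irreflexive : ∀ {n} → Adj n → Set
Irreflexive {n} E = (i : Fin n) → E i i ≡ false

Over : ∀ {n} → Adj n → List (Fin n × Fin n) → Set
Over {n} E E' = (u v : Fin n) → (u , v) ∈ E' → E u v ≡ true

anyB : {A : Set} → (A → Bool) → List A → Bool
anyB P [] = false
anyB P (x ∷ xs) = P x ∨ anyB P xs

allB : {A : Set} → (A → Bool) → List A → Bool
allB P [] = true
allB P (x ∷ xs) = P x ∧ allB P xs

eqB : ∀ {n} → Fin n → Fin n → Bool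
eqB i j = does (i ≟ j)

distinct : ∀ {n} → List (Fin n) → Bool
distinct [] = true
distinct (x ∷ xs) = not (anyB (eqB x) xs) ∧ distinct xs

allVecs : (n k : ℕ) → List (Vec (Fin n) k)
allVecs n zero = []ᵥ ∷ []
allVecs n (suc k) = concatMap (λ x → map (x ∷ᵥ_) (allVecs n k)) (allFin n)

isPerm : ∀ {n} → Vec (Fin n) n → Bool
isPerm σ = distinct (toList σ)

perms : (n : ℕ) → List (Vec (Fin n) n)
perms n = filter (λ σ → T? (isPerm σ)) (allVecs n n)

adjPairs : {A : Set} → List A → List (A × A)
adjPairs (x ∷ y ∷ xs) = (x , y) ∷ adjPairs (y ∷ xs)
adjPairs _ = []

isPathEdge : ∀ {n} → Vec (Fin n) n → Fin n → Fin n → Bool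
isPathEdge σ i j =
  anyB (λ { (a , b) → (eqB a i ∧ eqB b j) ∨ (eqB a j ∧ eqB b i) }) (adjPairs (toList σ))

precedesL : ∀ {n} → List (Fin n) → Fin n → Fin n → Bool
precedesL [] u v = false
precedesL (x ∷ xs) u v =
  if eqB x u then anyB (eqB v) xs else (if eqB x v then false else precedesL xs u v)

precedes : ∀ {n} → Vec (Fin n) n → Fin n → Fin n → Bool
precedes σ = precedesL (toList σ)

respects : ∀ {n} → Vec (Fin n) n → List (Fin n × Fin n) → Bool
respects σ E' = allB (λ { (u , v) → precedes σ u v }) E'

consistent : ∀ {n} → Adj n → List (Fin n × Fin n) → Vec (Fin n) n → Bool
consistent E E' σ = allB (λ { (a , b) → E a b }) (adjPairs (toList σ)) ∧ respects σ E'

pairs : (n : ℕ) → List (Fin n × Fin n)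
pairs n = filter (λ { (i , j) → toℕ i ℕ.<? toℕ j }) (cartesianProduct (allFin n) (allFin n))

prodℚ : List ℚ → ℚ
prodℚ = foldr _*_ 1ℚ

sumℚ : List ℚ → ℚ
sumℚ = foldr _+_ 0ℚ

indicator : Bool → ℚ
indicator b = if b then 1ℚ else 0ℚ

uniformMass : {A : Set} → List A → (A → Bool) → A → ℚ
uniformMass L P x with length L
... | zero = 0ℚ
... | suc k = if P x then (+ 1) / suc k else 0ℚ

permMass : (n : ℕ) → Vec (Fin n) n → ℚ
permMass n = uniformMass (perms n) isPerm

-- P(undirected graph = G | π = σ): path edges of σ are always present;
-- every other pair is present independently with probability p.
graphProbGiven : ∀ {n} → ℚ → Vec (Fin n) n → Adj n → ℚ
graphProbGiven {n} p σ E = prodℚ (map factor (pairs n))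
  where
  factor : Fin n × Fin n → ℚ
  factor (i , j) =
    if isPathEdge σ i j then indicator (E i j)
    else (if E i j then p else 1ℚ - p)

jointProb : ∀ n → ℚ → Adj n → List (Fin n × Fin n) → Vec (Fin n) n → ℚ
jointProb n p E E' σ = permMass n σ * graphProbGiven p σ E * indicator (respects σ E')

eventProb : ∀ n → ℚ → Adj n → List (Fin n × Fin n) → ℚ
eventProb n p E E' = sumℚ (map (jointProb n p E E') (perms n))

condProb : ∀ n → (p : ℚ) → (E : Adj n) → (E' : List (Fin n × Fin n)) →
           0ℚ < eventProb n p E E' → Vec (Fin n) n → ℚ
condProb n p E E' pos σ = _÷_ (jointProb n p E E' σ) (eventProb n p E E') {{>-nonZero pos}}

uniformConsistent : ∀ n → Adj n → List (Fin n × Fin n) → Vec (Fin n) n → ℚ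
uniformConsistent n E E' = uniformMass (filter (λ σ → T? (consistent E E' σ)) (perms n)) (consistent E E')

{-# OPTIONS --safe #-}
module Submission where

-- Given π = σ, the consecutive pairs of σ are edges for sure and every other pair is an
-- independent p-coin. So P(G | π = σ) vanishes unless σ runs along edges of G, and is then
-- ∏ w(e) · p^-(n-1) over all pairs e, with w(e) = p or 1 - p according as e ∈ E or not: the
-- n - 1 path edges contribute 1 instead of p. This does not depend on σ, and neither does the
-- uniform prior, so the joint weight of σ is a constant times [σ consistent with G and E'],
-- and normalising such a weight gives the uniform distribution on the consistent σ.

open import Defs
open import Data.Nat as ℕ using (ℕ; _≤_; zero; suc; _∸_)
import Data.Nat.Properties as ℕₚ
open import Data.Fin using (Fin; toℕ)
import Data.Fin.Properties as Fin
open import Data.List using (List; []; _∷_; map; filter; length; allFin; cartesianProduct)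
open import Data.List.Properties using (length-map; map-cong)
open import Data.List.Membership.Propositional using (_∈_)
open import Data.List.Membership.Propositional.Properties
  using (∈-filter⁺; ∈-filter⁻; ∈-map⁺; ∈-map⁻; ∈-allFin; ∈-cartesianProduct⁺)
open import Data.List.Membership.Propositional.Properties.WithK using (unique∧set⇒bag)
open import Data.List.Relation.Unary.Any using (here; there)
open import Data.List.Relation.Unary.All as All using (All; []; _∷_)
open import Data.List.Relation.Unary.AllPairs using ([]; _∷_)
open import Data.List.Relation.Unary.Unique.Propositional using (Unique)
import Data.List.Relation.Unary.Unique.Propositional.Properties as Unique
open import Data.List.Relation.Binary.BagAndSetEquality using (∼bag⇒↭)
open import Data.List.Relation.Binary.Permutation.Propositional.Properties using (↭-length)
open import Data.Vec using (Vec; toList)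
open import Data.Vec.Properties using (length-toList)
open import Data.Bool using (Bool; true; false; _∧_; _∨_; if_then_else_)
open import Data.Bool.Properties using (∨-zeroʳ; ∧-identityʳ; ∧-conicalˡ; ∧-conicalʳ; T-≡)
open import Data.Product using (_×_; _,_; proj₁; proj₂; ∃-syntax)
open import Data.Sum using (_⊎_; inj₁; inj₂)
open import Data.Integer as ℤ using (+_)
import Data.Integer.Properties as ℤₚ
open import Data.Rational using (ℚ; 0ℚ; 1ℚ; _<_; _+_; _-_; _*_; _/_; _÷_; 1/_; mkℚ; NonZero; >-nonZero)
import Data.Rational.Properties as ℚ
open import Data.Rational.Solver using (module +-*-Solver)
open import Algebra.Definitions.RawSemiring Data.Rational.+-*-rawSemiring using (_^_)
import Data.Nat.Coprimality as Coprime
open import Function using (_∘_; Equivalence; mk⇔)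
open import Relation.Nullary using (yes; no; contradiction)
open import Relation.Nullary.Decidable using (T?; dec-true)
open import Relation.Binary.PropositionalEquality
  using (_≡_; _≢_; refl; sym; trans; cong; cong₂; subst; module ≡-Reasoning)

eqB⇒≡ : ∀ {n} {i j : Fin n} → eqB i j ≡ true → i ≡ j
eqB⇒≡ {i = i} {j} i≟j with i Fin.≟ j | i≟j
... | yes i≡j | _  = i≡j
... | no  _   | ()

eqB-refl : ∀ {n} (i : Fin n) → eqB i i ≡ true
eqB-refl i = dec-true (i Fin.≟ i) refl

module _ {A : Set} (f : A → Bool) where

  anyB⁻ : ∀ xs → anyB f xs ≡ true → ∃[ x ] x ∈ xs × f x ≡ true
  anyB⁻ (x ∷ xs) any with f x in fx
  ... | true  = x , here refl , fx
  ... | false = let y , y∈xs , fy = anyB⁻ xs any in y , there y∈xs , fy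

  anyB⁺ : ∀ {xs x} → x ∈ xs → f x ≡ true → anyB f xs ≡ true
  anyB⁺ (here refl) fx rewrite fx = refl
  anyB⁺ {y ∷ _} (there x∈xs) fx rewrite anyB⁺ x∈xs fx = ∨-zeroʳ (f y)

  allB⁻ : ∀ {xs x} → allB f xs ≡ true → x ∈ xs → f x ≡ true
  allB⁻ {y ∷ _} all (here refl)  = ∧-conicalˡ (f y) _ all
  allB⁻ {y ∷ _} all (there x∈xs) = allB⁻ (∧-conicalʳ (f y) _ all) x∈xs

  allB-false⁻ : ∀ xs → allB f xs ≡ false → ∃[ x ] x ∈ xs × f x ≡ false
  allB-false⁻ (x ∷ xs) all with f x in fx
  ... | false = x , here refl , fx
  ... | true  = let y , y∈xs , fy = allB-false⁻ xs all in y , there y∈xs , fy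

distinct⇒Unique : ∀ {n} (xs : List (Fin n)) → distinct xs ≡ true → Unique xs
distinct⇒Unique []       _ = []
distinct⇒Unique (x ∷ xs) d with anyB (eqB x) xs in x∉xs
... | true  = contradiction d λ ()
... | false = All.tabulate x≢ ∷ distinct⇒Unique xs d
  where
  x≢ : ∀ {y} → y ∈ xs → x ≢ y
  x≢ y∈xs refl = contradiction (trans (sym (anyB⁺ (eqB x) y∈xs (eqB-refl x))) x∉xs) λ ()

count : {A : Set} → (A → Bool) → List A → ℕ
count P xs = length (filter (T? ∘ P) xs)

SameEdge : {A : Set} → A × A → A × A → Set
SameEdge (a , b) (i , j) = (a ≡ i × b ≡ j) ⊎ (a ≡ j × b ≡ i)

SameEdge-sym : {A : Set} {e e′ : A × A} → SameEdge e e′ → SameEdge e′ e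
SameEdge-sym {e = _ , _} {_ , _} (inj₁ (refl , refl)) = inj₁ (refl , refl)
SameEdge-sym {e = _ , _} {_ , _} (inj₂ (refl , refl)) = inj₂ (refl , refl)

SameEdge-trans : {A : Set} {e₁ e₂ e₃ : A × A} → SameEdge e₁ e₂ → SameEdge e₂ e₃ → SameEdge e₁ e₃
SameEdge-trans {e₁ = _ , _} {_ , _} {_ , _} (inj₁ (refl , refl)) s                    = s
SameEdge-trans {e₁ = _ , _} {_ , _} {_ , _} (inj₂ (refl , refl)) (inj₁ (refl , refl)) = inj₂ (refl , refl)
SameEdge-trans {e₁ = _ , _} {_ , _} {_ , _} (inj₂ (refl , refl)) (inj₂ (refl , refl)) = inj₁ (refl , refl)

sameEdgeᵇ : ∀ {n} → Fin n × Fin n → Fin n × Fin n → Bool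
sameEdgeᵇ (a , b) (i , j) = (eqB a i ∧ eqB b j) ∨ (eqB a j ∧ eqB b i)

sameEdgeᵇ⇒SameEdge : ∀ {n} {e e′ : Fin n × Fin n} → sameEdgeᵇ e e′ ≡ true → SameEdge e e′
sameEdgeᵇ⇒SameEdge {e = a , b} {i , j} same with eqB a i ∧ eqB b j in straight
... | true  = inj₁ (eqB⇒≡ (∧-conicalˡ _ _ straight) , eqB⇒≡ (∧-conicalʳ _ _ straight))
... | false = inj₂ (eqB⇒≡ (∧-conicalˡ _ _ same) , eqB⇒≡ (∧-conicalʳ _ _ same))

SameEdge⇒sameEdgeᵇ : ∀ {n} {e e′ : Fin n × Fin n} → SameEdge e e′ → sameEdgeᵇ e e′ ≡ true
SameEdge⇒sameEdgeᵇ {e = a , b} (inj₁ (refl , refl)) rewrite eqB-refl a | eqB-refl b = refl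
SameEdge⇒sameEdgeᵇ {e = a , b} (inj₂ (refl , refl)) rewrite eqB-refl a | eqB-refl b = ∨-zeroʳ _

orient : ∀ {n} → Fin n × Fin n → Fin n × Fin n
orient (a , b) with toℕ a ℕ.<? toℕ b
... | yes _ = a , b
... | no  _ = b , a

SameEdge-orient : ∀ {n} (e : Fin n × Fin n) → SameEdge e (orient e)
SameEdge-orient (a , b) with toℕ a ℕ.<? toℕ b
... | yes _ = inj₁ (refl , refl)
... | no  _ = inj₂ (refl , refl)

orient≡⇒SameEdge : ∀ {n} {e e′ : Fin n × Fin n} → orient e ≡ orient e′ → SameEdge e e′
orient≡⇒SameEdge {e = e} {e′} eq =
  SameEdge-trans (SameEdge-orient e) (subst (λ o → SameEdge o e′) (sym eq) (SameEdge-sym (SameEdge-orient e′)))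

∈-pairs⁺ : ∀ {n} {i j : Fin n} → toℕ i ℕ.< toℕ j → (i , j) ∈ pairs n
∈-pairs⁺ i<j = ∈-filter⁺ _ (∈-cartesianProduct⁺ (∈-allFin _) (∈-allFin _)) i<j

∈-pairs⁻ : ∀ {n} {i j : Fin n} → (i , j) ∈ pairs n → toℕ i ℕ.< toℕ j
∈-pairs⁻ {n} ij∈ = proj₂ (∈-filter⁻ _ {xs = cartesianProduct (allFin n) (allFin n)} ij∈)

pairs-unique : ∀ n → Unique (pairs n)
pairs-unique n = Unique.filter⁺ _ (Unique.cartesianProduct⁺ (Unique.allFin⁺ n) (Unique.allFin⁺ n))

orient∈pairs : ∀ {n} {a b : Fin n} → a ≢ b → orient (a , b) ∈ pairs n
orient∈pairs {a = a} {b} a≢b with toℕ a ℕ.<? toℕ b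
... | yes a<b = ∈-pairs⁺ a<b
... | no  a≮b = ∈-pairs⁺ (ℕₚ.≤∧≢⇒< (ℕₚ.≮⇒≥ a≮b) (a≢b ∘ Fin.toℕ-injective ∘ sym))

orient-canonical : ∀ {n} {e : Fin n × Fin n} {i j} → (i , j) ∈ pairs n → SameEdge e (i , j) →
                   orient e ≡ (i , j)
orient-canonical {e = a , b} ij∈ s with toℕ a ℕ.<? toℕ b | s
... | yes _   | inj₁ (refl , refl) = refl
... | yes j<i | inj₂ (refl , refl) = contradiction j<i (ℕₚ.<-asym (∈-pairs⁻ ij∈))
... | no  i≮j | inj₁ (refl , refl) = contradiction (∈-pairs⁻ ij∈) i≮j
... | no  _   | inj₂ (refl , refl) = refl

∈-adjPairs-∷⁻ : {A : Set} {a b : A} (y : A) (zs : List A) → (a , b) ∈ adjPairs (y ∷ zs) → b ∈ zs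
∈-adjPairs-∷⁻ y (z ∷ zs) (here refl)  = here refl
∈-adjPairs-∷⁻ y (z ∷ zs) (there ab∈) = there (∈-adjPairs-∷⁻ z zs ab∈)

adjPairs-irreflexive : {A : Set} {a b : A} {xs : List A} → Unique xs → (a , b) ∈ adjPairs xs → a ≢ b
adjPairs-irreflexive {xs = _ ∷ _ ∷ _} ((x≢y ∷ _) ∷ _) (here refl)  = x≢y
adjPairs-irreflexive {xs = _ ∷ _ ∷ _} (_ ∷ unique)   (there ab∈) = adjPairs-irreflexive unique ab∈

length-adjPairs : {A : Set} (xs : List A) → length (adjPairs xs) ≡ length xs ∸ 1
length-adjPairs []           = refl
length-adjPairs (_ ∷ [])     = refl
length-adjPairs (_ ∷ y ∷ zs) = cong suc (length-adjPairs (y ∷ zs))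

orient-adjPairs-unique : ∀ {n} {xs : List (Fin n)} → Unique xs → Unique (map orient (adjPairs xs))
orient-adjPairs-unique {xs = []}     _ = []
orient-adjPairs-unique {xs = _ ∷ []} _ = []
orient-adjPairs-unique {xs = x ∷ y ∷ zs} ((_ ∷ x∉zs) ∷ unique@(y∉zs ∷ _)) =
  All.tabulate fresh ∷ orient-adjPairs-unique unique
  where
  fresh : ∀ {o} → o ∈ map orient (adjPairs (y ∷ zs)) → orient (x , y) ≢ o
  fresh o∈ eq with ∈-map⁻ orient o∈
  ... | (a , b) , ab∈ , refl with orient≡⇒SameEdge eq | ∈-adjPairs-∷⁻ y zs ab∈
  ... | inj₁ (_ , refl) | b∈zs = All.lookup y∉zs b∈zs refl
  ... | inj₂ (refl , _) | b∈zs = All.lookup x∉zs b∈zs refl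

pathEdge : ∀ {n} → Vec (Fin n) n → Fin n × Fin n → Bool
pathEdge σ (i , j) = isPathEdge σ i j

pathEdge⁻ : ∀ {n} (σ : Vec (Fin n) n) {e} → pathEdge σ e ≡ true →
            ∃[ ab ] ab ∈ adjPairs (toList σ) × SameEdge ab e
pathEdge⁻ σ path = let ab , ab∈ , same = anyB⁻ _ (adjPairs (toList σ)) path
                   in ab , ab∈ , sameEdgeᵇ⇒SameEdge same

pathEdge⁺ : ∀ {n} (σ : Vec (Fin n) n) {ab e} → ab ∈ adjPairs (toList σ) → SameEdge ab e →
            pathEdge σ e ≡ true
pathEdge⁺ σ ab∈ same = anyB⁺ _ ab∈ (SameEdge⇒sameEdgeᵇ same)

-- The path edges among the pairs are, without repetition, the oriented consecutive pairs of σ.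
count-pathEdge : ∀ {n} (σ : Vec (Fin n) n) → Unique (toList σ) → count (pathEdge σ) (pairs n) ≡ n ∸ 1
count-pathEdge {n} σ σ-unique = begin
  length (filter (T? ∘ pathEdge σ) (pairs n)) ≡⟨ ↭-length (∼bag⇒↭ (unique∧set⇒bag path-unique orient-unique (mk⇔ to from))) ⟩
  length (map orient (adjPairs xs))           ≡⟨ length-map orient (adjPairs xs) ⟩
  length (adjPairs xs)                        ≡⟨ length-adjPairs xs ⟩
  length xs ∸ 1                               ≡⟨ cong (_∸ 1) (length-toList σ) ⟩
  n ∸ 1                                       ∎
  where
  open ≡-Reasoning
  xs = toList σ
  path-unique = Unique.filter⁺ _ (pairs-unique n)
  orient-unique = orient-adjPairs-unique σ-unique

  to : ∀ {e} → e ∈ filter (T? ∘ pathEdge σ) (pairs n) → e ∈ map orient (adjPairs xs)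
  to {i , j} e∈ with ∈-filter⁻ _ {xs = pairs n} e∈
  ... | ij∈ , path with pathEdge⁻ σ (Equivalence.to T-≡ path)
  ... | ab , ab∈ , same = subst (_∈ map orient (adjPairs xs)) (orient-canonical ij∈ same) (∈-map⁺ orient ab∈)

  from : ∀ {e} → e ∈ map orient (adjPairs xs) → e ∈ filter (T? ∘ pathEdge σ) (pairs n)
  from e∈ with ∈-map⁻ orient e∈
  ... | ab , ab∈ , refl = ∈-filter⁺ _ (orient∈pairs (adjPairs-irreflexive σ-unique ab∈))
                                      (Equivalence.from T-≡ (pathEdge⁺ σ ab∈ (SameEdge-orient ab)))

prodℚ-zero : {A : Set} (f : A → ℚ) {xs : List A} {x : A} → x ∈ xs → f x ≡ 0ℚ → prodℚ (map f xs) ≡ 0ℚ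
prodℚ-zero f {_ ∷ xs} (here refl) fx≡0 = trans (cong (_* prodℚ (map f xs)) fx≡0) (ℚ.*-zeroˡ (prodℚ (map f xs)))
prodℚ-zero f {y ∷ _}  (there x∈)  fx≡0 = trans (cong (f y *_) (prodℚ-zero f x∈ fx≡0)) (ℚ.*-zeroʳ (f y))

prodℚ-replace-by-1 : {A : Set} (h : A → Bool) (g : A → ℚ) {q : ℚ} →
                     (∀ {x} → h x ≡ true → g x * q ≡ 1ℚ) → ∀ xs → prodℚ (map (λ x → if h x then 1ℚ else g x) xs) ≡ prodℚ (map g xs) * q ^ count h xs
prodℚ-replace-by-1 h g         gq≡1 []       = refl
prodℚ-replace-by-1 h g {q} gq≡1 (x ∷ xs) with h x in hx
... | true  = begin
  1ℚ * F              ≡⟨ cong (1ℚ *_) (prodℚ-replace-by-1 h g gq≡1 xs) ⟩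
  1ℚ * (G * Q)        ≡⟨ cong (_* (G * Q)) (sym (gq≡1 hx)) ⟩
  (g x * q) * (G * Q) ≡⟨ solve 4 (λ a b c d → (a :* c) :* (b :* d) := (a :* b) :* (c :* d)) refl (g x) G q Q ⟩
  (g x * G) * (q * Q) ∎
  where
  open ≡-Reasoning
  open +-*-Solver
  F = prodℚ (map (λ x → if h x then 1ℚ else g x) xs)
  G = prodℚ (map g xs)
  Q = q ^ count h xs
... | false = trans (cong (g x *_) (prodℚ-replace-by-1 h g gq≡1 xs))
                    (sym (ℚ.*-assoc (g x) (prodℚ (map g xs)) (q ^ count h xs)))

FollowsEdges : ∀ {n} → Adj n → Vec (Fin n) n → Set
FollowsEdges E σ = ∀ {a b} → (a , b) ∈ adjPairs (toList σ) → E a b ≡ true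

module _ {n : ℕ} (p : ℚ) {E : Adj n} (E-sym : Symmetric E) where

  edgeWeight : Fin n × Fin n → ℚ
  edgeWeight (i , j) = if E i j then p else 1ℚ - p

  -- definitionally the factor that graphProbGiven multiplies over the pairs
  pairFactor : Vec (Fin n) n → Fin n × Fin n → ℚ
  pairFactor σ (i , j) = if pathEdge σ (i , j) then indicator (E i j) else edgeWeight (i , j)

  E-SameEdge : ∀ {a b i j} → SameEdge (a , b) (i , j) → E a b ≡ E i j
  E-SameEdge (inj₁ (refl , refl)) = refl
  E-SameEdge (inj₂ (refl , refl)) = E-sym _ _

  FollowsEdges-pathEdge : ∀ {σ i j} → FollowsEdges E σ → pathEdge σ (i , j) ≡ true → E i j ≡ true
  FollowsEdges-pathEdge {σ} follows path =
    let (a , b) , ab∈ , same = pathEdge⁻ σ path in trans (sym (E-SameEdge same)) (follows ab∈)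

  graphProbGiven-missingEdge : ∀ {σ a b} → Unique (toList σ) → (a , b) ∈ adjPairs (toList σ) →
                               E a b ≡ false → graphProbGiven p σ E ≡ 0ℚ
  graphProbGiven-missingEdge {σ} {a} {b} σ-unique ab∈ ab∉E =
    prodℚ-zero (pairFactor σ) (orient∈pairs (adjPairs-irreflexive σ-unique ab∈)) factor≡0
    where
    factor≡0 : pairFactor σ (orient (a , b)) ≡ 0ℚ
    factor≡0 with orient (a , b) | SameEdge-orient (a , b)
    ... | i , j | same rewrite pathEdge⁺ σ ab∈ same | sym (E-SameEdge same) | ab∉E = refl

  module _ .{{_ : NonZero p}} where

    graphProbOnPaths : ℚ
    graphProbOnPaths = prodℚ (map edgeWeight (pairs n)) * (1/ p) ^ (n ∸ 1)

    graphProbGiven-followsEdges : ∀ {σ} → Unique (toList σ) → FollowsEdges E σ →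
                                  graphProbGiven p σ E ≡ graphProbOnPaths
    graphProbGiven-followsEdges {σ} σ-unique follows = begin
      graphProbGiven p σ E
        ≡⟨ cong prodℚ (map-cong factor≡ (pairs n)) ⟩
      prodℚ (map (λ e → if pathEdge σ e then 1ℚ else edgeWeight e) (pairs n))
        ≡⟨ prodℚ-replace-by-1 (pathEdge σ) edgeWeight weight*1/p≡1 (pairs n) ⟩
      prodℚ (map edgeWeight (pairs n)) * (1/ p) ^ count (pathEdge σ) (pairs n)
        ≡⟨ cong (λ k → prodℚ (map edgeWeight (pairs n)) * (1/ p) ^ k) (count-pathEdge σ σ-unique) ⟩
      graphProbOnPaths ∎
      where
      open ≡-Reasoning
      factor≡ : ∀ e → pairFactor σ e ≡ (if pathEdge σ e then 1ℚ else edgeWeight e)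
      factor≡ (i , j) with pathEdge σ (i , j) in path
      ... | true rewrite FollowsEdges-pathEdge follows path = refl
      ... | false = refl
      weight*1/p≡1 : ∀ {e} → pathEdge σ e ≡ true → edgeWeight e * 1/ p ≡ 1ℚ
      weight*1/p≡1 path rewrite FollowsEdges-pathEdge follows path = ℚ.*-inverseʳ p

isPerm-perms : ∀ {n} {σ : Vec (Fin n) n} → σ ∈ perms n → isPerm σ ≡ true
isPerm-perms {n} σ∈ = Equivalence.to T-≡ (proj₂ (∈-filter⁻ _ {xs = allVecs n n} σ∈))

unique-perms : ∀ {n} {σ : Vec (Fin n) n} → σ ∈ perms n → Unique (toList σ)
unique-perms σ∈ = distinct⇒Unique _ (isPerm-perms σ∈)

uniformMass-constant : {A : Set} (xs : List A) (P : A → Bool) {x y : A} → P x ≡ true → P y ≡ true →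
                       uniformMass xs P x ≡ uniformMass xs P y
uniformMass-constant xs P Px Py with length xs
... | zero  = refl
... | suc _ rewrite Px | Py = refl

uniformMass-suc : {A : Set} (xs : List A) (P : A → Bool) {x : A} {k : ℕ} → length xs ≡ suc k →
                  uniformMass xs P x ≡ (if P x then + 1 / suc k else 0ℚ)
uniformMass-suc xs P |xs|≡1+k rewrite |xs|≡1+k = refl

m/1≡mkℚ : ∀ m → + m / 1 ≡ mkℚ (+ m) 0 (Coprime.sym (Coprime.1-coprimeTo m))
m/1≡mkℚ m = ℚ.normalize-coprime (Coprime.sym (Coprime.1-coprimeTo m))

1+m/1≡[1+m]/1 : ∀ m → 1ℚ + + m / 1 ≡ + suc m / 1
1+m/1≡[1+m]/1 m rewrite m/1≡mkℚ m = cong (λ z → (+ 1 ℤ.+ z) / 1) (ℤₚ.*-identityʳ (+ m))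

-- 1/ (mkℚ (+ suc k) 0 _) computes to mkℚ (+ 1) k _.
1/[1+k]*[1+k]/1≡1 : ∀ k → + 1 / suc k * (+ suc k / 1) ≡ 1ℚ
1/[1+k]*[1+k]/1≡1 k rewrite ℚ.normalize-coprime (Coprime.1-coprimeTo (suc k)) | m/1≡mkℚ (suc k) =
  ℚ.*-inverseˡ (mkℚ (+ suc k) 0 (Coprime.sym (Coprime.1-coprimeTo (suc k))))

z*y≡x⇒x÷y≡z : ∀ {x y z : ℚ} .{{_ : NonZero y}} → z * y ≡ x → x ÷ y ≡ z
z*y≡x⇒x÷y≡z {x} {y} {z} z*y≡x = begin
  x * 1/ y         ≡⟨ cong (_* 1/ y) z*y≡x ⟨
  (z * y) * 1/ y   ≡⟨ ℚ.*-assoc z y (1/ y) ⟩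
  z * (y * 1/ y)   ≡⟨ cong (z *_) (ℚ.*-inverseʳ y) ⟩
  z * 1ℚ           ≡⟨ ℚ.*-identityʳ z ⟩
  z                ∎
  where open ≡-Reasoning

module _ {A : Set} (P : A → Bool) (w : A → ℚ) (c : ℚ) where

  sumℚ-proportional : ∀ {xs} → (∀ {x} → x ∈ xs → w x ≡ c * indicator (P x)) →
                      sumℚ (map w xs) ≡ c * (+ count P xs / 1)
  sumℚ-proportional {[]}     _  = sym (ℚ.*-zeroʳ c)
  sumℚ-proportional {x ∷ xs} w≡ = begin
    w x + sumℚ (map w xs)                        ≡⟨ cong₂ _+_ (w≡ (here refl)) (sumℚ-proportional (w≡ ∘ there)) ⟩
    c * indicator (P x) + c * (+ count P xs / 1) ≡⟨ ℚ.*-distribˡ-+ c (indicator (P x)) (+ count P xs / 1) ⟨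
    c * (indicator (P x) + + count P xs / 1)     ≡⟨ cong (c *_) count-∷ ⟩
    c * (+ count P (x ∷ xs) / 1)                 ∎
    where
    open ≡-Reasoning
    count-∷ : indicator (P x) + + count P xs / 1 ≡ + count P (x ∷ xs) / 1
    count-∷ with P x
    ... | true  = 1+m/1≡[1+m]/1 (count P xs)
    ... | false = ℚ.+-identityˡ (+ count P xs / 1)

  ÷sumℚ-proportional≡uniformMass : ∀ {xs} → (∀ {x} → x ∈ xs → w x ≡ c * indicator (P x)) →
    (pos : 0ℚ < sumℚ (map w xs)) → ∀ {x} → x ∈ xs →
    (w x ÷ sumℚ (map w xs)) {{>-nonZero pos}} ≡ uniformMass (filter (T? ∘ P) xs) P x
  ÷sumℚ-proportional≡uniformMass {xs} w≡ pos {x} x∈ =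
    z*y≡x⇒x÷y≡z {{>-nonZero pos}} (uniform*sum≡w (count P xs) refl)
    where
    sum≡ : ∀ {m} → count P xs ≡ m → sumℚ (map w xs) ≡ c * (+ m / 1)
    sum≡ refl = sumℚ-proportional w≡

    L = filter (T? ∘ P) xs

    uniform*sum≡w : ∀ m → count P xs ≡ m → uniformMass L P x * sumℚ (map w xs) ≡ w x
    uniform*sum≡w zero    |P|≡0   =
      contradiction (subst (0ℚ <_) (trans (sum≡ |P|≡0) (ℚ.*-zeroʳ c)) pos) (ℚ.<-irrefl refl)
    uniform*sum≡w (suc k) |P|≡1+k = begin
      uniformMass L P x * sumℚ (map w xs)                        ≡⟨ cong₂ _*_ (uniformMass-suc L P |P|≡1+k) (sum≡ |P|≡1+k) ⟩
      (if P x then + 1 / suc k else 0ℚ) * (c * (+ suc k / 1)) ≡⟨ cancel (P x) ⟩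
      c * indicator (P x)                                       ≡⟨ w≡ x∈ ⟨
      w x                                                       ∎
      where
      open ≡-Reasoning
      cancel : ∀ b → (if b then + 1 / suc k else 0ℚ) * (c * (+ suc k / 1)) ≡ c * indicator b
      cancel true  = trans (solve 3 (λ u c m → u :* (c :* m) := c :* (u :* m)) refl (+ 1 / suc k) c (+ suc k / 1))
                           (cong (c *_) (1/[1+k]*[1+k]/1≡1 k))
        where open +-*-Solver
      cancel false = trans (ℚ.*-zeroˡ (c * (+ suc k / 1))) (sym (ℚ.*-zeroʳ c))

module _ {n : ℕ} (E : Adj n) (E′ : List (Fin n × Fin n)) (σ : Vec (Fin n) n) where

  consistent⇒FollowsEdges : consistent E E′ σ ≡ true → FollowsEdges E σ
  consistent⇒FollowsEdges c = allB⁻ _ (∧-conicalˡ _ _ c)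

  consistent⇒respects : consistent E E′ σ ≡ true → respects σ E′ ≡ true
  consistent⇒respects c = ∧-conicalʳ _ _ c

  inconsistent⇒violates⊎missingEdge : consistent E E′ σ ≡ false →
    respects σ E′ ≡ false ⊎ ∃[ ab ] ab ∈ adjPairs (toList σ) × E (proj₁ ab) (proj₂ ab) ≡ false
  inconsistent⇒violates⊎missingEdge c with respects σ E′ in r
  ... | false = inj₁ refl
  ... | true  = inj₂ (allB-false⁻ _ (adjPairs (toList σ)) (trans (sym (∧-identityʳ _)) c))

permMass-constant : ∀ {n} {σ τ : Vec (Fin n) n} → σ ∈ perms n → τ ∈ perms n → permMass n τ ≡ permMass n σ
permMass-constant {n} σ∈ τ∈ = uniformMass-constant (perms n) isPerm (isPerm-perms τ∈) (isPerm-perms σ∈)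

jointProb-proportional : ∀ {n} (p : ℚ) .{{_ : NonZero p}} {E : Adj n} (E-sym : Symmetric E) E′ {σ τ} →
  σ ∈ perms n → τ ∈ perms n →
  jointProb n p E E′ τ ≡ permMass n σ * graphProbOnPaths p E-sym * indicator (consistent E E′ τ)
jointProb-proportional {n} p {E} E-sym E′ {σ} {τ} σ∈ τ∈ with consistent E E′ τ in c
... | true  = cong₂ _*_ (cong₂ _*_ (permMass-constant σ∈ τ∈) graphProb≡) (cong indicator (consistent⇒respects E E′ τ c))
  where
  graphProb≡ = graphProbGiven-followsEdges p E-sym (unique-perms τ∈) (consistent⇒FollowsEdges E E′ τ c)
... | false = trans jointProb≡0 (sym (ℚ.*-zeroʳ (permMass n σ * graphProbOnPaths p E-sym)))
  where
  m = permMass n τ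
  g = graphProbGiven p τ E
  r = indicator (respects τ E′)
  jointProb≡0 : m * g * r ≡ 0ℚ
  jointProb≡0 with inconsistent⇒violates⊎missingEdge E E′ τ c
  ... | inj₁ violates = trans (cong (λ b → m * g * indicator b) violates) (ℚ.*-zeroʳ (m * g))
  ... | inj₂ (_ , ab∈ , ab∉E) = begin
    m * g * r  ≡⟨ cong (λ g → m * g * r) (graphProbGiven-missingEdge p E-sym (unique-perms τ∈) ab∈ ab∉E) ⟩
    m * 0ℚ * r ≡⟨ cong (_* r) (ℚ.*-zeroʳ m) ⟩
    0ℚ * r     ≡⟨ ℚ.*-zeroˡ r ⟩
    0ℚ         ∎
    where open ≡-Reasoning

proposition6 : (n : ℕ) → 2 ≤ n → (p : ℚ) → 0ℚ < p → p < 1ℚ →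
    (E : Adj n) → Symmetric E → Irreflexive E →
    (E' : List (Fin n × Fin n)) → Over E E' →
    (pos : 0ℚ < eventProb n p E E') →
    (σ : Vec (Fin n) n) → σ ∈ perms n →
    condProb n p E E' pos σ ≡ uniformConsistent n E E' σ
proposition6 n _ p 0<p _ E E-sym _ E' _ pos σ σ∈ =
  ÷sumℚ-proportional≡uniformMass (consistent E E') (jointProb n p E E') (permMass n σ * graphProbOnPaths p E-sym)
    (jointProb-proportional p E-sym E' σ∈) pos σ∈
  where
  instance
    p≢0 : NonZero p
    p≢0 = >-nonZero 0<p
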